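{- Consider the $8\times 8$ grid of blocks (the crossing gadget) whose block at (row $i$, column $j$), $0\le i,j\le 7$, is given by the following rows (listing columns $0$ to $7$; $0$ = fixed-value block, $\vee$ = disjunction, $\wedge$ = conjunction, $S$ = selector): row 0: $0,0,0,\vee,0,0,0,0$; row 1: $0,0,0,\vee,S,\vee,\vee,0$; row 2: $0,0,0,\vee,\wedge,0,\vee,0$; row 3: $\vee,\vee,\vee,\wedge,\vee,0,\vee,0$; row 4: $0,S,\wedge,\vee,\vee,\vee,\wedge,\vee$; row 5: $0,\vee,0,0,\vee,0,0,0$; row 6: $0,\vee,\vee,\vee,\wedge,0,0,0$; row 7: $0,0,0,0,\vee,0,0,0$. Let $a,b\in\{0,1\}$ be input values, fed as the west input of block $(3,0)$ and the north input of block $(0,3)$ respectively, and let $a'$ be the east output of block $(4,7)$ and $b'$ the south output of block $(7,4)$. Then: (a) for every truth-assignment of the two selectors, $a'\le a$ and $b'\le b$; (b) there exists a truth-assignment of the selectors such that $a'=a$ and $b'=b$.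
   Context: Each block at $(i,j)$ receives a north input (the south output of block $(i-1,j)$) and a west input (the east output of block $(i,j-1)$), except that block $(0,3)$ receives $b$ as north input and block $(3,0)$ receives $a$ as west input; all other inputs from outside the $8\times8$ grid are irrelevant since the corresponding boundary blocks are fixed-value blocks. A conjunction block outputs $s_N\wedge s_W$ on both its east and south outputs; a disjunction block outputs $s_N\vee s_W$ on both; a fixed-value block outputs $0$ on both; a selector block ignores its inputs and is either an east-selector (east output $1$, south output $0$) or a south-selector (east output $0$, south output $1$). A truth-assignment chooses, for each of the two selectors (at $(1,4)$ and $(4,1)$), whether it is an east- or south-selector. Outputs are computed in order of increasing $i+j$. -}

module Defs where

open import Data.Bool using (Bool; true; false; _∧_; _∨_)
open import Data.Nat using (ℕ; zero; suc)
open import Data.Product using (_×_; _,_; proj₁; proj₂)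

data Block : Set where
  fixed  : Block
  disj   : Block
  conj   : Block
  sel₁   : Block
  sel₂   : Block

data SelectorKind : Set where
  east-selector  : SelectorKind
  south-selector : SelectorKind

-- A truth-assignment: orientation of the selector at (1,4) and at (4,1).
Assignment : Set
Assignment = SelectorKind × SelectorKind

-- Rows of the crossing gadget (columns 0..7).  Outside the grid: fixed.
row : ℕ → ℕ → Block
row 0 3 = disj
row 1 3 = disj
row 1 4 = sel₁
row 1 5 = disj
row 1 6 = disj
row 2 3 = disj
row 2 4 = conj
row 2 6 = disj
row 3 0 = disj
row 3 1 = disj
row 3 2 = disj
row 3 3 = conj
row 3 4 = disj
row 3 6 = disj
row 4 1 = sel₂
row 4 2 = conj
row 4 3 = disj
row 4 4 = disj
row 4 5 = disj
row 4 6 = conj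
row 4 7 = disj
row 5 1 = disj
row 5 4 = disj
row 6 1 = disj
row 6 2 = disj
row 6 3 = disj
row 6 4 = conj
row 7 4 = disj
row _ _ = fixed

selOut : SelectorKind → Bool × Bool
selOut east-selector  = true , false
selOut south-selector = false , true

-- (east output , south output) of a block given its north and west inputs.
blockOut : Assignment → Block → Bool → Bool → Bool × Bool
blockOut σ fixed n w = false , false
blockOut σ disj  n w = n ∨ w , n ∨ w
blockOut σ conj  n w = n ∧ w , n ∧ w
blockOut σ sel₁  n w = selOut (proj₁ σ)
blockOut σ sel₂  n w = selOut (proj₂ σ)

-- External inputs: north input of (0,3) is b, west input of (3,0) is a;
-- all other external inputs are irrelevant (their blocks are fixed) and set to 0.
northExt : Bool → ℕ → Bool
northExt b 3 = b
northExt b _ = false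

westExt : Bool → ℕ → Bool
westExt a 3 = a
westExt a _ = false

-- out σ a b i j = (east output , south output) of block (i,j).
-- Recursion on (i,j) realises the evaluation order by increasing i+j.
out : Assignment → Bool → Bool → ℕ → ℕ → Bool × Bool
out σ a b zero    zero    = blockOut σ (row 0 0) (northExt b 0) (westExt a 0)
out σ a b zero    (suc j) = blockOut σ (row 0 (suc j)) (northExt b (suc j)) (proj₁ (out σ a b zero j))
out σ a b (suc i) zero    = blockOut σ (row (suc i) 0) (proj₂ (out σ a b i 0)) (westExt a (suc i))
out σ a b (suc i) (suc j) = blockOut σ (row (suc i) (suc j)) (proj₂ (out σ a b i (suc j))) (proj₁ (out σ a b (suc i) j))

a′ : Assignment → Bool → Bool → Bool
a′ σ a b = proj₁ (out σ a b 4 7)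

b′ : Assignment → Bool → Bool → Bool
b′ σ a b = proj₂ (out σ a b 7 4)

module Submission where

-- The crossing gadget computes two Boolean functions a′ and b′ of the inputs
-- a, b and the orientations (s₁ , s₂) of its two selectors.  The proof first
-- determines these functions in closed form:
--
--   a′ = a ∧ (s₁ is east) ∧ (s₂ is east  ∨ b)
--   b′ = b ∧ (s₂ is south) ∧ (s₁ is south ∨ a)
--
-- (each is checked by evaluating the grid on all finitely many inputs).
-- Since each output is its own input conjoined with a guard, part (a),
-- a′ ≤ a and b′ ≤ b, is the inequality x ∧ y ≤ x.  For part (b) we orient
-- the selector at (1,4) east exactly when a = 1 and the selector at (4,1)
-- south exactly when b = 1; then both guards evaluate to true whenever the
-- corresponding input is 1, so a′ = a and b′ = b.

open import Defs
open import Data.Bool using (Bool; true; false; not; _∧_; _∨_; _≤_; b≤b)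
open import Data.Bool.Properties using (≤-maximum)
open import Data.Product using (_×_; _,_; ∃)
open import Relation.Binary.PropositionalEquality using (_≡_; refl; subst; sym; trans)

isEast : SelectorKind → Bool
isEast east-selector  = true
isEast south-selector = false

isSouth : SelectorKind → Bool
isSouth s = not (isEast s)

a′-closed : ∀ (s₁ s₂ : SelectorKind) (a b : Bool) →
            a′ (s₁ , s₂) a b ≡ a ∧ (isEast s₁ ∧ (isEast s₂ ∨ b))
a′-closed east-selector  east-selector  false false = refl
a′-closed east-selector  east-selector  false true  = refl
a′-closed east-selector  east-selector  true  false = refl
a′-closed east-selector  east-selector  true  true  = refl
a′-closed east-selector  south-selector false false = refl
a′-closed east-selector  south-selector false true  = refl
a′-closed east-selector  south-selector true  false = refl
a′-closed east-selector  south-selector true  true  = refl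
a′-closed south-selector east-selector  false false = refl
a′-closed south-selector east-selector  false true  = refl
a′-closed south-selector east-selector  true  false = refl
a′-closed south-selector east-selector  true  true  = refl
a′-closed south-selector south-selector false false = refl
a′-closed south-selector south-selector false true  = refl
a′-closed south-selector south-selector true  false = refl
a′-closed south-selector south-selector true  true  = refl

b′-closed : ∀ (s₁ s₂ : SelectorKind) (a b : Bool) →
            b′ (s₁ , s₂) a b ≡ b ∧ (isSouth s₂ ∧ (isSouth s₁ ∨ a))
b′-closed east-selector  east-selector  false false = refl
b′-closed east-selector  east-selector  false true  = refl
b′-closed east-selector  east-selector  true  false = refl
b′-closed east-selector  east-selector  true  true  = refl
b′-closed east-selector  south-selector false false = refl
b′-closed east-selector  south-selector false true  = refl
b′-closed east-selector  south-selector true  false = refl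
b′-closed east-selector  south-selector true  true  = refl
b′-closed south-selector east-selector  false false = refl
b′-closed south-selector east-selector  false true  = refl
b′-closed south-selector east-selector  true  false = refl
b′-closed south-selector east-selector  true  true  = refl
b′-closed south-selector south-selector false false = refl
b′-closed south-selector south-selector false true  = refl
b′-closed south-selector south-selector true  false = refl
b′-closed south-selector south-selector true  true  = refl

∧-≤ˡ : ∀ (x y : Bool) → x ∧ y ≤ x
∧-≤ˡ false y = b≤b
∧-≤ˡ true  y = ≤-maximum y

eastIf : Bool → SelectorKind
eastIf true  = east-selector
eastIf false = south-selector

faithful : Bool → Bool → Assignment
faithful a b = eastIf a , eastIf (not b)

a-guard-passes : ∀ (a b : Bool) →
                 a ∧ (isEast (eastIf a) ∧ (isEast (eastIf (not b)) ∨ b)) ≡ a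
a-guard-passes false b     = refl
a-guard-passes true  false = refl
a-guard-passes true  true  = refl

b-guard-passes : ∀ (a b : Bool) →
                 b ∧ (isSouth (eastIf (not b)) ∧ (isSouth (eastIf a) ∨ a)) ≡ b
b-guard-passes a     false = refl
b-guard-passes false true  = refl
b-guard-passes true  true  = refl

lemma6 : (∀ (σ : Assignment) (a b : Bool) → (a′ σ a b ≤ a) × (b′ σ a b ≤ b))
    × (∀ (a b : Bool) → ∃ λ (σ : Assignment) → (a′ σ a b ≡ a) × (b′ σ a b ≡ b))
lemma6 = outputs-bounded , outputs-recoverable
  where
  outputs-bounded : ∀ (σ : Assignment) (a b : Bool) → (a′ σ a b ≤ a) × (b′ σ a b ≤ b)
  outputs-bounded (s₁ , s₂) a b =
      subst (_≤ a) (sym (a′-closed s₁ s₂ a b)) (∧-≤ˡ a _)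
    , subst (_≤ b) (sym (b′-closed s₁ s₂ a b)) (∧-≤ˡ b _)

  outputs-recoverable : ∀ (a b : Bool) → ∃ λ (σ : Assignment) → (a′ σ a b ≡ a) × (b′ σ a b ≡ b)
  outputs-recoverable a b =
      faithful a b
    , trans (a′-closed (eastIf a) (eastIf (not b)) a b) (a-guard-passes a b)
    , trans (b′-closed (eastIf a) (eastIf (not b)) a b) (b-guard-passes a b)
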